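{- Let $k\ge 9$ be an integer and $r\in\mathbb{Z}_{2k}$. If $T_3(k,r)$ is connected, then it is isomorphic to either a prism or a M\"obius ladder.
   Context: $T_3(k,r)$ is the graph with vertex set $\{u_i,v_i,w_i: i\in\mathbb{Z}_{2k}\}$ and edges $u_iu_{i+k}$, $v_iv_{i+k}$, $w_iw_{i+k}$, $u_iv_i$, $u_iw_i$, $v_iw_{i+r}$ ($i\in\mathbb{Z}_{2k}$). A prism of order $2n$ is $C_n\square K_2$; a M\"obius ladder of order $2n$ is a $2n$-cycle together with all edges joining antipodal vertices. -}

module Defs where

open import Level using (0ℓ)
open import Data.Nat using (ℕ; _+_; _*_)
open import Data.Fin using (Fin; toℕ)
open import Data.Product using (Σ; ∃-syntax; _×_; _,_)
open import Data.Sum using (_⊎_)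
open import Relation.Binary.PropositionalEquality using (_≡_)
open import Relation.Nullary using (¬_)
open import Relation.Binary.Construct.Closure.ReflexiveTransitive using (Star)
open import Function.Bundles using (_↔_; Inverse)

record Graph : Set₁ where
  field
    V   : Set
    Adj : V → V → Set

open Graph public

ModEq : ℕ → ℕ → ℕ → Set
ModEq N a b = ∃[ q ] (a ≡ b + q * N ⊎ b ≡ a + q * N)

-- Elements of ℤ_N are represented by Fin N; i ≡ j + c  in ℤ_N.
IsShift : (N : ℕ) → Fin N → ℕ → Fin N → Set
IsShift N j c i = ModEq N (toℕ j) (toℕ i + c)

data Cls : Set where
  u v w : Cls

-- Adjacency of T₃(k,r): vertices (c , i) with c ∈ {u,v,w}, i ∈ ℤ_{2k}.
-- Edges: u_i u_{i+k}, v_i v_{i+k}, w_i w_{i+k}, u_i v_i, u_i w_i, v_i w_{i+r}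
-- (taken symmetrically).
T3Adj : (k : ℕ) → Fin (2 * k) → (Cls × Fin (2 * k)) → (Cls × Fin (2 * k)) → Set
T3Adj k r (u , i) (u , j) = IsShift (2 * k) j k i
T3Adj k r (v , i) (v , j) = IsShift (2 * k) j k i
T3Adj k r (w , i) (w , j) = IsShift (2 * k) j k i
T3Adj k r (u , i) (v , j) = i ≡ j
T3Adj k r (v , i) (u , j) = i ≡ j
T3Adj k r (u , i) (w , j) = i ≡ j
T3Adj k r (w , i) (u , j) = i ≡ j
T3Adj k r (v , i) (w , j) = IsShift (2 * k) j (toℕ r) i
T3Adj k r (w , j) (v , i) = IsShift (2 * k) j (toℕ r) i

T3 : (k : ℕ) → Fin (2 * k) → Graph
T3 k r = record { V = Cls × Fin (2 * k) ; Adj = T3Adj k r }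

-- Prism of order 2n: C_n □ K_2, vertices (a , s) with a ∈ ℤ_n, s ∈ Fin 2.
PrismAdj : (n : ℕ) → (Fin n × Fin 2) → (Fin n × Fin 2) → Set
PrismAdj n (a , s) (b , t) =
  (s ≡ t × (IsShift n b 1 a ⊎ IsShift n a 1 b)) ⊎ (a ≡ b × ¬ (s ≡ t))

Prism : ℕ → Graph
Prism n = record { V = Fin n × Fin 2 ; Adj = PrismAdj n }

-- Möbius ladder of order 2n: the cycle on ℤ_{2n} plus all antipodal chords.
MobiusAdj : (n : ℕ) → Fin (2 * n) → Fin (2 * n) → Set
MobiusAdj n i j = IsShift (2 * n) j 1 i ⊎ IsShift (2 * n) i 1 j ⊎ IsShift (2 * n) j n i

Mobius : ℕ → Graph
Mobius n = record { V = Fin (2 * n) ; Adj = MobiusAdj n }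

Connected : Graph → Set
Connected G = ∀ x y → Star (Adj G) x y

record _≅_ (G H : Graph) : Set where
  field
    bij      : V G ↔ V H
  open Inverse bij public using (to)
  field
    adj-iff  : ∀ x y → (Adj G x y → Adj H (to x) (to y)) × (Adj H (to x) (to y) → Adj G x y)

module Submission where

-- Every vertex x of T₃(k,r) has exactly three neighbours: next x, the vertex
-- whose next is x, and the antipode opp x, where
--   next u_i = v_i,   next v_i = w_{i+r},   next w_i = u_i,   opp c_i = c_{i+k}.
-- Call a graph whose adjacency is generated in this way by a pair of
-- self-maps (nxt, opp) a ladder.  Unrolling the orbit
--     of a vertex under next then gives a map of ladders from the prism of
--     order 6k, resp. from the Möbius ladder of order 6k, and the covering
--     lemma turns it into an isomorphism.  (The hypothesis k ≥ 9 of the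
--     theorem is only used through k ≥ 1.)

open import Defs
open import Data.Nat using (ℕ; zero; suc; _+_; _*_; _∸_; _≤_; _≥_; pred; NonZero; s≤s)
open import Data.Nat.Properties
  using (+-assoc; +-comm; +-identityʳ; *-identityˡ; *-suc; *-distribʳ-+;
         ≤-total; m+[n∸m]≡n; m≤m*n; suc-pred; 1+n≰n)
open import Data.Nat.DivMod
  using (_%_; _/_; _mod_; m%n<n; m<n⇒m%n≡m; m≡m%n+[m/n]*n; [m+kn]%n≡m%n;
         %-distribˡ-+; m%n%n≡m%n)
open import Data.Nat.GeneralisedArithmetic using (fold; fold-+)
open import Data.Nat.Tactic.RingSolver using (solve-∀)
open import Data.Fin using (Fin; toℕ; punchOut; opposite; _≟_)
import Data.Fin as F
open import Data.Fin.Properties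
  using (toℕ-injective; toℕ<n; toℕ-fromℕ<; *↔×; any?; punchOut-injective; injective⇒≤)
open import Data.Product using (∃-syntax; _×_; _,_; proj₁; proj₂)
open import Data.Product.Function.NonDependent.Propositional using (_×-↔_)
open import Data.Sum using (_⊎_; inj₁; inj₂)
open import Data.Empty using (⊥-elim)
open import Relation.Nullary using (¬_; yes; no)
open import Relation.Binary.PropositionalEquality
open import Relation.Binary.Construct.Closure.ReflexiveTransitive using (Star; ε; _◅_)
open import Function.Base using (_∘_)
open import Function.Bundles using (_↔_; Inverse; Injection; mk↔ₛ′)
open import Function.Definitions using (Injective)
open import Function.Properties.Inverse using (↔-refl; ↔-sym; ↔-trans; ↔⇒↣)

open ≡-Reasoning

module Cyclic (N : ℕ) .{{_ : NonZero N}} where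

  _⊕_ : Fin N → ℕ → Fin N
  i ⊕ c = (toℕ i + c) mod N

  toℕ-⊕ : ∀ i c → toℕ (i ⊕ c) ≡ (toℕ i + c) % N
  toℕ-⊕ i c = toℕ-fromℕ< (m%n<n (toℕ i + c) N)

  toℕ-% : ∀ (i : Fin N) → toℕ i % N ≡ toℕ i
  toℕ-% i = m<n⇒m%n≡m (toℕ<n i)

  ⊕-cong : ∀ i a j b → (toℕ i + a) % N ≡ (toℕ j + b) % N → i ⊕ a ≡ j ⊕ b
  ⊕-cong i a j b e = toℕ-injective (trans (toℕ-⊕ i a) (trans e (sym (toℕ-⊕ j b))))

  ⊕-identityʳ : ∀ i → i ⊕ 0 ≡ i
  ⊕-identityʳ i = toℕ-injective (begin
    toℕ (i ⊕ 0)        ≡⟨ toℕ-⊕ i 0 ⟩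
    (toℕ i + 0) % N    ≡⟨ cong (_% N) (+-identityʳ (toℕ i)) ⟩
    toℕ i % N          ≡⟨ toℕ-% i ⟩
    toℕ i              ∎)

  ⊕-assoc : ∀ i a b → (i ⊕ a) ⊕ b ≡ i ⊕ (a + b)
  ⊕-assoc i a b = ⊕-cong (i ⊕ a) b i (a + b) (begin
    (toℕ (i ⊕ a) + b) % N        ≡⟨ cong (λ z → (z + b) % N) (toℕ-⊕ i a) ⟩
    ((toℕ i + a) % N + b) % N    ≡⟨ %-absorbˡ (toℕ i + a) b ⟩
    (toℕ i + a + b) % N          ≡⟨ cong (_% N) (+-assoc (toℕ i) a b) ⟩
    (toℕ i + (a + b)) % N        ∎)
    where
    %-absorbˡ : ∀ x y → (x % N + y) % N ≡ (x + y) % N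
    %-absorbˡ x y = begin
      (x % N + y) % N           ≡⟨ %-distribˡ-+ (x % N) y N ⟩
      (x % N % N + y % N) % N   ≡⟨ cong (λ z → (z + y % N) % N) (m%n%n≡m%n x N) ⟩
      (x % N + y % N) % N       ≡⟨ %-distribˡ-+ x y N ⟨
      (x + y) % N               ∎

  ⊕-swap : ∀ i a b → (i ⊕ a) ⊕ b ≡ (i ⊕ b) ⊕ a
  ⊕-swap i a b = begin
    (i ⊕ a) ⊕ b   ≡⟨ ⊕-assoc i a b ⟩
    i ⊕ (a + b)   ≡⟨ cong (i ⊕_) (+-comm a b) ⟩
    i ⊕ (b + a)   ≡⟨ ⊕-assoc i b a ⟨
    (i ⊕ b) ⊕ a   ∎

  ⊕-period : ∀ i a q → i ⊕ (a + q * N) ≡ i ⊕ a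
  ⊕-period i a q = ⊕-cong i (a + q * N) i a (begin
    (toℕ i + (a + q * N)) % N   ≡⟨ cong (_% N) (+-assoc (toℕ i) a (q * N)) ⟨
    (toℕ i + a + q * N) % N     ≡⟨ [m+kn]%n≡m%n (toℕ i + a) q N ⟩
    (toℕ i + a) % N             ∎)

  ⊕-full-turn : ∀ i → i ⊕ N ≡ i
  ⊕-full-turn i = begin
    i ⊕ N           ≡⟨ cong (i ⊕_) (*-identityˡ N) ⟨
    i ⊕ (0 + 1 * N) ≡⟨ ⊕-period i 0 1 ⟩
    i ⊕ 0           ≡⟨ ⊕-identityʳ i ⟩
    i               ∎

  ⊕-undo : ∀ i a → (i ⊕ a) ⊕ (a * pred N) ≡ i
  ⊕-undo i a = begin
    (i ⊕ a) ⊕ (a * pred N)   ≡⟨ ⊕-assoc i a (a * pred N) ⟩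
    i ⊕ (a + a * pred N)     ≡⟨ cong (i ⊕_) (*-suc a (pred N)) ⟨
    i ⊕ (a * suc (pred N))   ≡⟨ cong (λ z → i ⊕ (a * z)) (suc-pred N) ⟩
    i ⊕ (0 + a * N)          ≡⟨ ⊕-period i 0 a ⟩
    i ⊕ 0                    ≡⟨ ⊕-identityʳ i ⟩
    i                        ∎

  ⊕-cancelʳ : ∀ i j a → i ⊕ a ≡ j ⊕ a → i ≡ j
  ⊕-cancelʳ i j a e = begin
    i                        ≡⟨ ⊕-undo i a ⟨
    (i ⊕ a) ⊕ (a * pred N)   ≡⟨ cong (_⊕ (a * pred N)) e ⟩
    (j ⊕ a) ⊕ (a * pred N)   ≡⟨ ⊕-undo j a ⟩
    j                        ∎

  ⊕-pred-suc : ∀ i → (i ⊕ pred N) ⊕ 1 ≡ i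
  ⊕-pred-suc i = begin
    (i ⊕ pred N) ⊕ 1   ≡⟨ ⊕-assoc i (pred N) 1 ⟩
    i ⊕ (pred N + 1)   ≡⟨ cong (i ⊕_) (trans (+-comm (pred N) 1) (suc-pred N)) ⟩
    i ⊕ N              ≡⟨ ⊕-full-turn i ⟩
    i                  ∎

  modEq⇒%≡ : ∀ a b → ModEq N a b → a % N ≡ b % N
  modEq⇒%≡ a b (q , inj₁ e) = trans (cong (_% N) e) ([m+kn]%n≡m%n b q N)
  modEq⇒%≡ a b (q , inj₂ e) = sym (trans (cong (_% N) e) ([m+kn]%n≡m%n a q N))

  quotient-gap : ∀ a b → a % N ≡ b % N → b / N ≤ a / N → a ≡ b + (a / N ∸ b / N) * N
  quotient-gap a b e le = begin
    a                             ≡⟨ m≡m%n+[m/n]*n a N ⟩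
    a % N + a / N * N             ≡⟨ cong₂ (λ x y → x + y * N) (sym e) (m+[n∸m]≡n le) ⟨
    b % N + (b / N + d) * N       ≡⟨ cong (b % N +_) (*-distribʳ-+ N (b / N) d) ⟩
    b % N + (b / N * N + d * N)   ≡⟨ +-assoc (b % N) (b / N * N) (d * N) ⟨
    b % N + b / N * N + d * N     ≡⟨ cong (_+ d * N) (m≡m%n+[m/n]*n b N) ⟨
    b + d * N                     ∎
    where d = a / N ∸ b / N

  %≡⇒modEq : ∀ a b → a % N ≡ b % N → ModEq N a b
  %≡⇒modEq a b e with ≤-total (b / N) (a / N)
  ... | inj₁ b/N≤a/N = a / N ∸ b / N , inj₁ (quotient-gap a b e b/N≤a/N)
  ... | inj₂ a/N≤b/N = b / N ∸ a / N , inj₂ (quotient-gap b a (sym e) a/N≤b/N)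

  isShift⇒≡ : ∀ j c i → IsShift N j c i → j ≡ i ⊕ c
  isShift⇒≡ j c i s = toℕ-injective (begin
    toℕ j               ≡⟨ toℕ-% j ⟨
    toℕ j % N           ≡⟨ modEq⇒%≡ (toℕ j) (toℕ i + c) s ⟩
    (toℕ i + c) % N     ≡⟨ toℕ-⊕ i c ⟨
    toℕ (i ⊕ c)         ∎)

  ≡⇒isShift : ∀ j c i → j ≡ i ⊕ c → IsShift N j c i
  ≡⇒isShift _ c i refl = %≡⇒modEq _ _ (trans (toℕ-% (i ⊕ c)) (toℕ-⊕ i c))

-- An injective endomap of a finite set is onto: otherwise, punching out a
-- missed value would inject Fin (1 + m) into Fin m.
injective⇒surjective : ∀ {m} (h : Fin m → Fin m) → Injective _≡_ _≡_ h → ∀ j → ∃[ i ] h i ≡ j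
injective⇒surjective {zero} h h-inj ()
injective⇒surjective {suc m} h h-inj j with any? (λ i → h i ≟ j)
... | yes hit = hit
... | no miss = ⊥-elim (1+n≰n (injective⇒≤ squeeze-injective))
  where
  avoids : ∀ i → ¬ j ≡ h i
  avoids i e = miss (i , sym e)

  squeeze : Fin (suc m) → Fin m
  squeeze i = punchOut (avoids i)

  squeeze-injective : Injective _≡_ _≡_ squeeze
  squeeze-injective e = h-inj (punchOut-injective (avoids _) (avoids _) e)

section⇒retraction : ∀ {X Y : Set} {m} → X ↔ Fin m → Y ↔ Fin m →
  (f : X → Y) (s : Y → X) → (∀ y → f (s y) ≡ y) → ∀ x → s (f x) ≡ x
section⇒retraction {m = m} X↔ Y↔ f s fs x with injective⇒surjective h h-injective (X.to x)
  where
  module X = Inverse X↔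
  module Y = Inverse Y↔

  h : Fin m → Fin m
  h = X.to ∘ s ∘ Y.from

  h-injective : Injective _≡_ _≡_ h
  h-injective {a} {b} e = begin
    a                         ≡⟨ Y.strictlyInverseˡ a ⟨
    Y.to (Y.from a)           ≡⟨ cong Y.to (fs (Y.from a)) ⟨
    Y.to (f (s (Y.from a)))   ≡⟨ cong (Y.to ∘ f) (Injection.injective (↔⇒↣ X↔) e) ⟩
    Y.to (f (s (Y.from b)))   ≡⟨ cong Y.to (fs (Y.from b)) ⟩
    Y.to (Y.from b)           ≡⟨ Y.strictlyInverseˡ b ⟩
    b                         ∎
... | j , hj = begin
  s (f x)                     ≡⟨ cong (s ∘ f) y≡x ⟨
  s (f (s y))                 ≡⟨ cong s (fs y) ⟩
  s y                         ≡⟨ y≡x ⟩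
  x                           ∎
  where
  y = Inverse.from Y↔ j
  y≡x : s y ≡ x
  y≡x = Injection.injective (↔⇒↣ X↔) hj

LadderAdj : {X : Set} → (X → X) → (X → X) → X → X → Set
LadderAdj nxt opp x y = y ≡ nxt x ⊎ x ≡ nxt y ⊎ y ≡ opp x

record Ladder (G : Graph) : Set where
  field
    nxt opp : V G → V G
    adj⇒    : ∀ x y → Adj G x y → LadderAdj nxt opp x y
    adj⇐    : ∀ x y → LadderAdj nxt opp x y → Adj G x y

record LadderMap {H G : Graph} (LH : Ladder H) (LG : Ladder G) : Set where
  field
    map     : V H → V G
    map-nxt : ∀ b → map (Ladder.nxt LH b) ≡ Ladder.nxt LG (map b)
    map-opp : ∀ b → map (Ladder.opp LH b) ≡ Ladder.opp LG (map b)

module Covering {G H : Graph} (LG : Ladder G) (LH : Ladder H) (Φ : LadderMap LH LG) where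
  open Ladder LG renaming (nxt to nxtG; opp to oppG; adj⇒ to adjG⇒; adj⇐ to adjG⇐)
  open Ladder LH renaming (nxt to nxtH; opp to oppH; adj⇒ to adjH⇒; adj⇐ to adjH⇐)
  open LadderMap Φ

  -- The image of Φ is closed under taking neighbours, provided that nxt is
  -- injective on G and onto on H (so that "previous" vertices lift as well).
  image-closed : Injective _≡_ _≡_ nxtG → (∀ b → ∃[ b' ] nxtH b' ≡ b) →
    ∀ b y → Adj G (map b) y → ∃[ b' ] map b' ≡ y
  image-closed nxtG-injective prev b y a with adjG⇒ (map b) y a
  ... | inj₁ y≡nxt = nxtH b , trans (map-nxt b) (sym y≡nxt)
  ... | inj₂ (inj₂ y≡opp) = oppH b , trans (map-opp b) (sym y≡opp)
  ... | inj₂ (inj₁ b≡nxt) with prev b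
  ...   | b' , nxt-b'≡b = b' , nxtG-injective (begin
    nxtG (map b')   ≡⟨ map-nxt b' ⟨
    map (nxtH b')   ≡⟨ cong map nxt-b'≡b ⟩
    map b           ≡⟨ b≡nxt ⟩
    nxtG y          ∎)

  -- Hence walks from a point of the image stay in the image: Φ is onto.
  surjective : Injective _≡_ _≡_ nxtG → (∀ b → ∃[ b' ] nxtH b' ≡ b) →
    V H → Connected G → ∀ y → ∃[ b ] map b ≡ y
  surjective nxtG-injective prev b₀ conn y = lift (conn (map b₀) y) (b₀ , refl)
    where
    lift : ∀ {x y} → Star (Adj G) x y → ∃[ b ] map b ≡ x → ∃[ b ] map b ≡ y
    lift ε        in-image   = in-image
    lift (a ◅ as) (b , refl) = lift as (image-closed nxtG-injective prev b _ a)

  bijective⇒iso : (g : V G → V H) → (∀ y → map (g y) ≡ y) → (∀ b → g (map b) ≡ b) → G ≅ H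
  bijective⇒iso g map-g g-map = record
    { bij     = mk↔ₛ′ g map g-map map-g
    ; adj-iff = λ x y → forward x y , backward x y
    }
    where
    map-injective : ∀ {a b} → map a ≡ map b → a ≡ b
    map-injective {a} {b} e = trans (sym (g-map a)) (trans (cong g e) (g-map b))

    reflect : ∀ a b → LadderAdj nxtG oppG (map a) (map b) → LadderAdj nxtH oppH a b
    reflect a b (inj₁ e)        = inj₁ (map-injective (trans e (sym (map-nxt a))))
    reflect a b (inj₂ (inj₁ e)) = inj₂ (inj₁ (map-injective (trans e (sym (map-nxt b)))))
    reflect a b (inj₂ (inj₂ e)) = inj₂ (inj₂ (map-injective (trans e (sym (map-opp a)))))

    preserve : ∀ a b → LadderAdj nxtH oppH a b → LadderAdj nxtG oppG (map a) (map b)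
    preserve a b (inj₁ e)        = inj₁ (trans (cong map e) (map-nxt a))
    preserve a b (inj₂ (inj₁ e)) = inj₂ (inj₁ (trans (cong map e) (map-nxt b)))
    preserve a b (inj₂ (inj₂ e)) = inj₂ (inj₂ (trans (cong map e) (map-opp a)))

    forward : ∀ x y → Adj G x y → Adj H (g x) (g y)
    forward x y a = adjH⇐ (g x) (g y) (reflect (g x) (g y)
      (subst₂ (LadderAdj nxtG oppG) (sym (map-g x)) (sym (map-g y)) (adjG⇒ x y a)))

    backward : ∀ x y → Adj H (g x) (g y) → Adj G x y
    backward x y a = adjG⇐ x y
      (subst₂ (LadderAdj nxtG oppG) (map-g x) (map-g y) (preserve (g x) (g y) (adjH⇒ (g x) (g y) a)))

  covering-iso : ∀ {m} → Injective _≡_ _≡_ nxtG → (∀ b → ∃[ b' ] nxtH b' ≡ b) →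
    V H → Connected G → V G ↔ Fin m → V H ↔ Fin m → G ≅ H
  covering-iso nxtG-injective prev b₀ conn G↔ H↔ =
    bijective⇒iso g map-g (section⇒retraction H↔ G↔ map g map-g)
    where
    onto : ∀ y → ∃[ b ] map b ≡ y
    onto = surjective nxtG-injective prev b₀ conn

    g : V G → V H
    g y = proj₁ (onto y)

    map-g : ∀ y → map (g y) ≡ y
    map-g y = proj₂ (onto y)

module Orbit {X : Set} (f : X → X) (x₀ : X) (P : ℕ) .{{_ : NonZero P}}
             (periodic : fold x₀ f P ≡ x₀) where
  open Cyclic P

  orbit : Fin P → X
  orbit a = fold x₀ f (toℕ a)

  fold-multiple : ∀ q → fold x₀ f (q * P) ≡ x₀
  fold-multiple zero    = refl
  fold-multiple (suc q) = begin
    fold x₀ f (P + q * P)          ≡⟨ fold-+ x₀ f P ⟩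
    fold (fold x₀ f (q * P)) f P   ≡⟨ cong (λ z → fold z f P) (fold-multiple q) ⟩
    fold x₀ f P                    ≡⟨ periodic ⟩
    x₀                             ∎

  fold-% : ∀ a → fold x₀ f (a % P) ≡ fold x₀ f a
  fold-% a = begin
    fold x₀ f (a % P)                          ≡⟨ cong (λ z → fold z f (a % P)) (fold-multiple (a / P)) ⟨
    fold (fold x₀ f (a / P * P)) f (a % P)     ≡⟨ fold-+ x₀ f (a % P) ⟨
    fold x₀ f (a % P + a / P * P)              ≡⟨ cong (fold x₀ f) (m≡m%n+[m/n]*n a P) ⟨
    fold x₀ f a                                ∎

  orbit-⊕ : ∀ a c → orbit (a ⊕ c) ≡ fold (orbit a) f c
  orbit-⊕ a c = begin
    fold x₀ f (toℕ (a ⊕ c))       ≡⟨ cong (fold x₀ f) (toℕ-⊕ a c) ⟩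
    fold x₀ f ((toℕ a + c) % P)   ≡⟨ fold-% (toℕ a + c) ⟩
    fold x₀ f (toℕ a + c)         ≡⟨ cong (fold x₀ f) (+-comm (toℕ a) c) ⟩
    fold x₀ f (c + toℕ a)         ≡⟨ fold-+ x₀ f c ⟩
    fold (orbit a) f c            ∎

module PrismLadder (n : ℕ) .{{_ : NonZero n}} where
  open Cyclic n

  opposite-≢ : ∀ (s : Fin 2) → ¬ s ≡ opposite s
  opposite-≢ F.zero ()
  opposite-≢ (F.suc F.zero) ()

  opposite-unique : ∀ (s t : Fin 2) → ¬ s ≡ t → t ≡ opposite s
  opposite-unique F.zero         F.zero         s≢t = ⊥-elim (s≢t refl)
  opposite-unique F.zero         (F.suc F.zero) s≢t = refl
  opposite-unique (F.suc F.zero) F.zero         s≢t = refl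
  opposite-unique (F.suc F.zero) (F.suc F.zero) s≢t = ⊥-elim (s≢t refl)

  around across : Fin n × Fin 2 → Fin n × Fin 2
  around (a , s) = a ⊕ 1 , s
  across (a , s) = a , opposite s

  around-prev : ∀ b → ∃[ b' ] around b' ≡ b
  around-prev (a , s) = (a ⊕ pred n , s) , cong (_, s) (⊕-pred-suc a)

  prism-adj⇒ : ∀ x y → PrismAdj n x y → LadderAdj around across x y
  prism-adj⇒ (a , s) (b , t) (inj₁ (refl , inj₁ b=a+1)) = inj₁ (cong (_, s) (isShift⇒≡ b 1 a b=a+1))
  prism-adj⇒ (a , s) (b , t) (inj₁ (refl , inj₂ a=b+1)) = inj₂ (inj₁ (cong (_, s) (isShift⇒≡ a 1 b a=b+1)))
  prism-adj⇒ (a , s) (b , t) (inj₂ (refl , s≢t))        = inj₂ (inj₂ (cong (a ,_) (opposite-unique s t s≢t)))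

  prism-adj⇐ : ∀ x y → LadderAdj around across x y → PrismAdj n x y
  prism-adj⇐ (a , s) _ (inj₁ refl)        = inj₁ (refl , inj₁ (≡⇒isShift (a ⊕ 1) 1 a refl))
  prism-adj⇐ _ (b , t) (inj₂ (inj₁ refl)) = inj₁ (refl , inj₂ (≡⇒isShift (b ⊕ 1) 1 b refl))
  prism-adj⇐ (a , s) _ (inj₂ (inj₂ refl)) = inj₂ (refl , opposite-≢ s)

  prism-ladder : Ladder (Prism n)
  prism-ladder = record { nxt = around ; opp = across ; adj⇒ = prism-adj⇒ ; adj⇐ = prism-adj⇐ }

  prism-size : (Fin n × Fin 2) ↔ Fin (n * 2)
  prism-size = ↔-sym *↔×

module MobiusLadder (n : ℕ) .{{_ : NonZero (2 * n)}} where
  open Cyclic (2 * n)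

  forth antipode : Fin (2 * n) → Fin (2 * n)
  forth i    = i ⊕ 1
  antipode i = i ⊕ n

  forth-prev : ∀ i → ∃[ j ] forth j ≡ i
  forth-prev i = i ⊕ pred (2 * n) , ⊕-pred-suc i

  mobius-adj⇒ : ∀ i j → MobiusAdj n i j → LadderAdj forth antipode i j
  mobius-adj⇒ i j (inj₁ j=i+1)        = inj₁ (isShift⇒≡ j 1 i j=i+1)
  mobius-adj⇒ i j (inj₂ (inj₁ i=j+1)) = inj₂ (inj₁ (isShift⇒≡ i 1 j i=j+1))
  mobius-adj⇒ i j (inj₂ (inj₂ j=i+n)) = inj₂ (inj₂ (isShift⇒≡ j n i j=i+n))

  mobius-adj⇐ : ∀ i j → LadderAdj forth antipode i j → MobiusAdj n i j
  mobius-adj⇐ i j (inj₁ e)        = inj₁ (≡⇒isShift j 1 i e)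
  mobius-adj⇐ i j (inj₂ (inj₁ e)) = inj₂ (inj₁ (≡⇒isShift i 1 j e))
  mobius-adj⇐ i j (inj₂ (inj₂ e)) = inj₂ (inj₂ (≡⇒isShift j n i e))

  mobius-ladder : Ladder (Mobius n)
  mobius-ladder = record { nxt = forth ; opp = antipode ; adj⇒ = mobius-adj⇒ ; adj⇐ = mobius-adj⇐ }

even-or-odd : ∀ m → ∃[ h ] (m ≡ h * 2 ⊎ m ≡ 1 + h * 2)
even-or-odd m with m % 2 | m≡m%n+[m/n]*n m 2 | m%n<n m 2
... | 0           | m≡2h   | _ = m / 2 , inj₁ m≡2h
... | 1           | m≡1+2h | _ = m / 2 , inj₂ m≡1+2h
... | suc (suc _) | _      | s≤s (s≤s ())

Cls↔Fin3 : Cls ↔ Fin 3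
Cls↔Fin3 = mk↔ₛ′ to from to-from from-to
  where
  to : Cls → Fin 3
  to u = F.zero
  to v = F.suc F.zero
  to w = F.suc (F.suc F.zero)

  from : Fin 3 → Cls
  from F.zero                 = u
  from (F.suc F.zero)         = v
  from (F.suc (F.suc F.zero)) = w

  to-from : ∀ i → to (from i) ≡ i
  to-from F.zero                 = refl
  to-from (F.suc F.zero)         = refl
  to-from (F.suc (F.suc F.zero)) = refl

  from-to : ∀ c → from (to c) ≡ c
  from-to u = refl
  from-to v = refl
  from-to w = refl

module T3Ladder (k' : ℕ) (r : Fin (2 * suc k')) where
  k : ℕ
  k = suc k'

  open Cyclic (2 * k)

  Vertex : Set
  Vertex = Cls × Fin (2 * k)

  next opp : Vertex → Vertex
  next (u , i) = v , i
  next (v , i) = w , i ⊕ toℕ r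
  next (w , i) = u , i
  opp (c , i) = c , i ⊕ k

  adj-next : ∀ x → T3Adj k r x (next x)
  adj-next (u , i) = refl
  adj-next (v , i) = ≡⇒isShift (i ⊕ toℕ r) (toℕ r) i refl
  adj-next (w , i) = refl

  adj-prev : ∀ x → T3Adj k r (next x) x
  adj-prev (u , i) = refl
  adj-prev (v , i) = ≡⇒isShift (i ⊕ toℕ r) (toℕ r) i refl
  adj-prev (w , i) = refl

  adj-opp : ∀ x → T3Adj k r x (opp x)
  adj-opp (u , i) = ≡⇒isShift (i ⊕ k) k i refl
  adj-opp (v , i) = ≡⇒isShift (i ⊕ k) k i refl
  adj-opp (w , i) = ≡⇒isShift (i ⊕ k) k i refl

  t3-adj⇒ : ∀ x y → T3Adj k r x y → LadderAdj next opp x y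
  t3-adj⇒ (u , i) (u , j) j=i+k = inj₂ (inj₂ (cong (u ,_) (isShift⇒≡ j k i j=i+k)))
  t3-adj⇒ (v , i) (v , j) j=i+k = inj₂ (inj₂ (cong (v ,_) (isShift⇒≡ j k i j=i+k)))
  t3-adj⇒ (w , i) (w , j) j=i+k = inj₂ (inj₂ (cong (w ,_) (isShift⇒≡ j k i j=i+k)))
  t3-adj⇒ (u , i) (v , j) refl  = inj₁ refl
  t3-adj⇒ (v , i) (u , j) refl  = inj₂ (inj₁ refl)
  t3-adj⇒ (u , i) (w , j) refl  = inj₂ (inj₁ refl)
  t3-adj⇒ (w , i) (u , j) refl  = inj₁ refl
  t3-adj⇒ (v , i) (w , j) j=i+r = inj₁ (cong (w ,_) (isShift⇒≡ j (toℕ r) i j=i+r))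
  t3-adj⇒ (w , j) (v , i) j=i+r = inj₂ (inj₁ (cong (w ,_) (isShift⇒≡ j (toℕ r) i j=i+r)))

  t3-adj⇐ : ∀ x y → LadderAdj next opp x y → T3Adj k r x y
  t3-adj⇐ x _ (inj₁ refl)        = adj-next x
  t3-adj⇐ _ y (inj₂ (inj₁ refl)) = adj-prev y
  t3-adj⇐ x _ (inj₂ (inj₂ refl)) = adj-opp x

  t3-ladder : Ladder (T3 k r)
  t3-ladder = record { nxt = next ; opp = opp ; adj⇒ = t3-adj⇒ ; adj⇐ = t3-adj⇐ }

  t3-size : Vertex ↔ Fin (3 * (2 * k))
  t3-size = ↔-trans (Cls↔Fin3 ×-↔ ↔-refl) (↔-sym *↔×)

  next-injective : Injective _≡_ _≡_ next
  next-injective {u , i} {u , j} e = cong (u ,_) (cong proj₂ e)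
  next-injective {v , i} {v , j} e = cong (v ,_) (⊕-cancelʳ i j (toℕ r) (cong proj₂ e))
  next-injective {w , i} {w , j} e = cong (w ,_) (cong proj₂ e)
  next-injective {u , _} {v , _} ()
  next-injective {u , _} {w , _} ()
  next-injective {v , _} {u , _} ()
  next-injective {v , _} {w , _} ()
  next-injective {w , _} {u , _} ()
  next-injective {w , _} {v , _} ()

  next-opp : ∀ x → next (opp x) ≡ opp (next x)
  next-opp (u , i) = refl
  next-opp (v , i) = cong (w ,_) (⊕-swap i k (toℕ r))
  next-opp (w , i) = refl

  opp-involutive : ∀ x → opp (opp x) ≡ x
  opp-involutive (c , i) = cong (c ,_) (begin
    (i ⊕ k) ⊕ k         ≡⟨ ⊕-assoc i k k ⟩
    i ⊕ (k + k)         ≡⟨ cong (λ z → i ⊕ (k + z)) (+-identityʳ k) ⟨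
    i ⊕ (2 * k)         ≡⟨ ⊕-full-turn i ⟩
    i                   ∎)

  -- Three steps of next move within a class by r, so 3m steps move by m r.
  next-3m : ∀ m c i → fold (c , i) next (3 * m) ≡ (c , i ⊕ (m * toℕ r))
  next-3m zero    c i = cong (c ,_) (sym (⊕-identityʳ i))
  next-3m (suc m) c i = begin
    fold (c , i) next (3 * suc m)                    ≡⟨ cong (fold (c , i) next) (*-suc 3 m) ⟩
    fold (fold (c , i) next (3 * m)) next 3          ≡⟨ cong (λ x → fold x next 3) (next-3m m c i) ⟩
    fold (c , i ⊕ (m * toℕ r)) next 3                ≡⟨ next³ c ⟩
    (c , (i ⊕ (m * toℕ r)) ⊕ toℕ r)                  ≡⟨ cong (c ,_) (⊕-assoc i (m * toℕ r) (toℕ r)) ⟩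
    (c , i ⊕ (m * toℕ r + toℕ r))                    ≡⟨ cong (λ z → c , i ⊕ z) (+-comm (m * toℕ r) (toℕ r)) ⟩
    (c , i ⊕ (suc m * toℕ r))                        ∎
    where
    next³ : ∀ c {j} → fold (c , j) next 3 ≡ (c , j ⊕ toℕ r)
    next³ u = refl
    next³ v = refl
    next³ w = refl

  -- After 3k steps, next has gone half way round: it is the identity when
  -- r is even and the antipodal map opp when r is odd.
  data HalfTurn : Set where
    rotation   : (∀ x → fold x next (3 * k) ≡ x) → HalfTurn
    reflection : (∀ x → fold x next (3 * k) ≡ opp x) → HalfTurn

  half-turn : HalfTurn
  half-turn with even-or-odd (toℕ r)
  ... | h , inj₁ r≡2h = rotation λ { (c , i) → begin
    fold (c , i) next (3 * k)     ≡⟨ next-3m k c i ⟩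
    (c , i ⊕ (k * toℕ r))         ≡⟨ cong (λ z → c , i ⊕ z) (trans (cong (k *_) r≡2h) (even-turns k h)) ⟩
    (c , i ⊕ (0 + h * (2 * k)))   ≡⟨ cong (c ,_) (trans (⊕-period i 0 h) (⊕-identityʳ i)) ⟩
    (c , i)                       ∎ }
    where
    even-turns : ∀ k h → k * (h * 2) ≡ 0 + h * (2 * k)
    even-turns = solve-∀
  ... | h , inj₂ r≡1+2h = reflection λ { (c , i) → begin
    fold (c , i) next (3 * k)     ≡⟨ next-3m k c i ⟩
    (c , i ⊕ (k * toℕ r))         ≡⟨ cong (λ z → c , i ⊕ z) (trans (cong (k *_) r≡1+2h) (odd-turns k h)) ⟩
    (c , i ⊕ (k + h * (2 * k)))   ≡⟨ cong (c ,_) (⊕-period i k h) ⟩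
    opp (c , i)                   ∎ }
    where
    odd-turns : ∀ k h → k * (1 + h * 2) ≡ k + h * (2 * k)
    odd-turns = solve-∀

  prism-iso : (∀ x → fold x next (3 * k) ≡ x) → Connected (T3 k r) → T3 k r ≅ Prism (3 * k)
  prism-iso next³ᵏ≡id conn =
    Covering.covering-iso t3-ladder prism-ladder unroll next-injective around-prev
      (F.zero , F.zero) conn t3-size (subst (λ m → (Fin (3 * k) × Fin 2) ↔ Fin m) (sizes k) prism-size)
    where
    open PrismLadder (3 * k)
    open Orbit next (u , F.zero) (3 * k) (next³ᵏ≡id (u , F.zero))

    sizes : ∀ k → 3 * k * 2 ≡ 3 * (2 * k)
    sizes = solve-∀

    side : Fin 2 → Vertex → Vertex
    side F.zero    x = x
    side (F.suc _) x = opp x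

    side-next : ∀ s x → side s (next x) ≡ next (side s x)
    side-next F.zero    x = refl
    side-next (F.suc _) x = sym (next-opp x)

    side-opposite : ∀ s x → side (opposite s) x ≡ opp (side s x)
    side-opposite F.zero         x = refl
    side-opposite (F.suc F.zero) x = sym (opp-involutive x)

    unroll : LadderMap prism-ladder t3-ladder
    unroll = record
      { map     = λ { (a , s) → side s (orbit a) }
      ; map-nxt = λ { (a , s) → trans (cong (side s) (orbit-⊕ a 1)) (side-next s (orbit a)) }
      ; map-opp = λ { (a , s) → side-opposite s (orbit a) }
      }

  mobius-iso : (∀ x → fold x next (3 * k) ≡ opp x) → Connected (T3 k r) → T3 k r ≅ Mobius (3 * k)
  mobius-iso next³ᵏ≡opp conn =
    Covering.covering-iso t3-ladder mobius-ladder unroll next-injective forth-prev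
      F.zero conn t3-size (subst (λ m → Fin (2 * (3 * k)) ↔ Fin m) (sizes k) ↔-refl)
    where
    open MobiusLadder (3 * k)

    sizes : ∀ k → 2 * (3 * k) ≡ 3 * (2 * k)
    sizes = solve-∀

    full-turn : ∀ x → fold x next (2 * (3 * k)) ≡ x
    full-turn x = begin
      fold x next (2 * (3 * k))                ≡⟨ cong (λ z → fold x next (3 * k + z)) (+-identityʳ (3 * k)) ⟩
      fold x next (3 * k + 3 * k)              ≡⟨ fold-+ x next (3 * k) ⟩
      fold (fold x next (3 * k)) next (3 * k)  ≡⟨ cong (λ y → fold y next (3 * k)) (next³ᵏ≡opp x) ⟩
      fold (opp x) next (3 * k)                ≡⟨ next³ᵏ≡opp (opp x) ⟩
      opp (opp x)                              ≡⟨ opp-involutive x ⟩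
      x                                        ∎

    open Orbit next (u , F.zero) (2 * (3 * k)) (full-turn (u , F.zero))

    unroll : LadderMap mobius-ladder t3-ladder
    unroll = record
      { map     = orbit
      ; map-nxt = λ a → orbit-⊕ a 1
      ; map-opp = λ a → trans (orbit-⊕ a (3 * k)) (next³ᵏ≡opp (orbit a))
      }

theorem6p1 : (k : ℕ) → k ≥ 9 → (r : Fin (2 * k)) → Connected (T3 k r) →
    ∃[ n ] (3 ≤ n × (T3 k r ≅ Prism n ⊎ T3 k r ≅ Mobius n))
theorem6p1 (suc k') _ r conn with T3Ladder.half-turn k' r
... | T3Ladder.rotation next³ᵏ≡id =
  3 * suc k' , m≤m*n 3 (suc k') , inj₁ (T3Ladder.prism-iso k' r next³ᵏ≡id conn)
... | T3Ladder.reflection next³ᵏ≡opp =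
  3 * suc k' , m≤m*n 3 (suc k') , inj₂ (T3Ladder.mobius-iso k' r next³ᵏ≡opp conn)
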